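{- Let $\beta\in E$ be such that $T=E(\mathbb{1},\beta)$ is a scattered point of $\mathrm{PG}(1,E)$. Then: (i) a point $P\in\mathrm{PG}(1,E)$ belongs to $L_T$ if and only if there exists $u\in\mathbb{F}_{q^t}^*$ with $P=E(\mathbb{1},\rho_{u^\beta/u})$; (ii) the set $I=\{u^\beta/u: u\in\mathbb{F}_{q^t}^*\}$ has exactly $\theta_{t-1}$ elements; (iii) for all $u,v\in\mathbb{F}_{q^t}^*$, $u$ and $v$ are $\mathbb{F}_q$-linearly dependent if and only if $u^\beta/u=v^\beta/v$; (iv) the kernel of $\beta$ has $\mathbb{F}_q$-dimension at most one; (v) $\beta$ is not invertible (singular) if and only if $E(\mathbb{1},0)\in L_T$.
   Context: Let $q$ be a prime power, $t\ge 2$, and $E=\mathrm{End}_{\mathbb{F}_q}(\mathbb{F}_{q^t})$, the ring of $\mathbb{F}_q$-linear maps $\mathbb{F}_{q^t}\to\mathbb{F}_{q^t}$. Maps are written on the right, $x\mapsto x^\alpha$, and composed left to right. Let $\mathbb{1}$ be the identity map and $E^*$ the group of units of $E$. For $a\in\mathbb{F}_{q^t}$ let $\rho_a\in E$ be $x\mapsto ax$. $E^2$ is a left $E$-module of row vectors with $\mathrm{GL}_2(E)$ acting from the right. A pair $(\alpha,\beta)\in E^2$ is admissible if it is the first row of a matrix in $\mathrm{GL}_2(E)$. The projective line $\mathrm{PG}(1,E)$ is the set of cyclic submodules $E(\alpha,\beta)$ with $(\alpha,\beta)$ admissible (points); $E(\alpha,\beta)=E(\alpha',\beta')$ iff $(\alpha',\beta')=(\gamma\alpha,\gamma\beta)$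 for some $\gamma\in E^*$. Two points $E(\alpha,\beta),E(\gamma,\delta)$ are distant if the matrix with rows $(\alpha,\beta)$, $(\gamma,\delta)$ lies in $\mathrm{GL}_2(E)$, non-distant otherwise. $\mathrm{PG}(1,F)$ denotes $\{E(\rho_a,\rho_b): (a,b)\in\mathbb{F}_{q^t}^2\setminus\{(0,0)\}\}\subseteq\mathrm{PG}(1,E)$. For a point $T$, $L_T$ is the set of points of $\mathrm{PG}(1,F)$ non-distant to $T$. Put $\theta_{t-1}=(q^t-1)/(q-1)$; $T$ is scattered if $|L_T|=\theta_{t-1}$. -}

module Defs where

open import Level using (Level; _⊔_)
open import Algebra.Bundles using (CommutativeRing)
open import Data.Nat using (ℕ; zero; suc; _^_; _∸_)
open import Data.Nat.DivMod using (_/_)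
open import Data.Product using (Σ; ∃; ∃₂; _×_; _,_; proj₁; proj₂)
open import Data.List using (List; length)
open import Data.List.Relation.Unary.All using (All)
open import Data.List.Relation.Unary.Any using (Any)
open import Data.List.Relation.Unary.AllPairs using (AllPairs)
open import Relation.Nullary using (¬_)
open import Relation.Binary.PropositionalEquality using (_≡_)
open import Data.Nat.Primality using (Prime)
open import Function.Bundles using (_⇔_)
import Algebra.Properties.CommutativeSemigroup as CSProps

-- θ_{t-1} = (q^t - 1)/(q - 1).  (Only used for q ≥ 2; value for q < 2 is a dummy 0.)
θ : ℕ → ℕ → ℕ
θ zero t = 0
θ (suc zero) t = 0
θ (suc (suc k)) t = ((suc (suc k)) ^ t ∸ 1) / suc k

-- "the set of ~-classes of elements satisfying P has exactly n elements":
-- a list of n pairwise non-equivalent P-elements meeting every P-class.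
HasSizeMod : ∀ {a r p} {A : Set a} (_~_ : A → A → Set r) (P : A → Set p) → ℕ → Set (a ⊔ r ⊔ p)
HasSizeMod {A = A} _~_ P n =
  Σ (List A) λ xs → length xs ≡ n × AllPairs (λ x y → ¬ (x ~ y)) xs × All P xs
                    × (∀ x → P x → Any (x ~_) xs)

record FieldStr {c ℓ : Level} (R : CommutativeRing c ℓ) : Set (c ⊔ ℓ) where
  open CommutativeRing R
  field
    0≉1   : ¬ (0# ≈ 1#)
    inv   : (x : Carrier) → ¬ (x ≈ 0#) → Carrier
    inv-r : (x : Carrier) (nz : ¬ (x ≈ 0#)) → x * inv x nz ≈ 1#

record IsSubfield {c ℓ k : Level} (R : CommutativeRing c ℓ) (Fs : FieldStr R)
                  (K : CommutativeRing.Carrier R → Set k) : Set (c ⊔ ℓ ⊔ k) where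
  open CommutativeRing R
  open FieldStr Fs
  field
    K-resp : ∀ {x y} → x ≈ y → K x → K y
    K-0    : K 0#
    K-1    : K 1#
    K-+    : ∀ {x y} → K x → K y → K (x + y)
    K-neg  : ∀ {x} → K x → K (- x)
    K-*    : ∀ {x y} → K x → K y → K (x * y)
    K-inv  : ∀ {x} (nz : ¬ (x ≈ 0#)) → K x → K (inv x nz)

module Setup {c ℓ k : Level} (R : CommutativeRing c ℓ) (Fs : FieldStr R)
             (K : CommutativeRing.Carrier R → Set k) where
  open CommutativeRing R
  open FieldStr Fs

  -- E = End_K(F): K-linear maps F → F (written on the right: x ↦ x^α = ap α x)
  record End : Set (c ⊔ ℓ ⊔ k) where
    field
      ap       : Carrier → Carrier
      ap-cong  : ∀ {x y} → x ≈ y → ap x ≈ ap y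
      additive : ∀ x y → ap (x + y) ≈ ap x + ap y
      homog    : ∀ a x → K a → ap (a * x) ≈ a * ap x
  open End public

  infix 4 _≈E_
  _≈E_ : End → End → Set (c ⊔ ℓ)
  α ≈E β = ∀ x → ap α x ≈ ap β x


  1E : End
  1E = record { ap = λ x → x ; ap-cong = λ e → e ; additive = λ _ _ → refl ; homog = λ _ _ _ → refl }

  0E : End
  0E = record { ap = λ _ → 0# ; ap-cong = λ _ → refl
              ; additive = λ _ _ → sym (+-identityˡ 0#) ; homog = λ a _ _ → sym (zeroʳ a) }

  infixl 6 _+E_
  _+E_ : End → End → End
  α +E β = record
    { ap = λ x → ap α x + ap β x
    ; ap-cong = λ e → +-cong (ap-cong α e) (ap-cong β e)
    ; additive = λ x y → trans (+-cong (additive α x y) (additive β x y))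
                               (CSProps.interchange +-commutativeSemigroup (ap α x) (ap α y) (ap β x) (ap β y))
    ; homog = λ a x Ka → trans (+-cong (homog α a x Ka) (homog β a x Ka)) (sym (distribˡ a (ap α x) (ap β x)))
    }

  -- product in E, maps composed left to right: x^(αβ) = (x^α)^β
  infixl 7 _·E_
  _·E_ : End → End → End
  α ·E β = record
    { ap = λ x → ap β (ap α x)
    ; ap-cong = λ e → ap-cong β (ap-cong α e)
    ; additive = λ x y → trans (ap-cong β (additive α x y)) (additive β (ap α x) (ap α y))
    ; homog = λ a x Ka → trans (ap-cong β (homog α a x Ka)) (homog β a (ap α x) Ka)
    }

  ρ : Carrier → End
  ρ a = record
    { ap = λ x → a * x
    ; ap-cong = λ e → *-congˡ e
    ; additive = λ x y → distribˡ a x y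
    ; homog = λ b x _ → CSProps.x∙yz≈y∙xz *-commutativeSemigroup a b x
    }

  IsUnitE : End → Set (c ⊔ ℓ ⊔ k)
  IsUnitE α = Σ End λ γ → (α ·E γ ≈E 1E) × (γ ·E α ≈E 1E)

  -- the matrix with rows (a , b) , (c' , d) lies in GL₂(E)
  -- (row-by-column product, entries multiplied in E)
  InGL₂ : End → End → End → End → Set (c ⊔ ℓ ⊔ k)
  InGL₂ a b c' d = Σ End λ a' → Σ End λ b' → Σ End λ c'' → Σ End λ d' →
      ((a ·E a' +E b ·E c'' ≈E 1E) × (a ·E b' +E b ·E d' ≈E 0E) ×
       (c' ·E a' +E d ·E c'' ≈E 0E) × (c' ·E b' +E d ·E d' ≈E 1E))
      ×
      ((a' ·E a +E b' ·E c' ≈E 1E) × (a' ·E b +E b' ·E d ≈E 0E) ×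
       (c'' ·E a +E d' ·E c' ≈E 0E) × (c'' ·E b +E d' ·E d ≈E 1E))

  Admissible : End → End → Set (c ⊔ ℓ ⊔ k)
  Admissible α β = Σ End λ γ → Σ End λ δ → InGL₂ α β γ δ

  SamePoint : (End × End) → (End × End) → Set (c ⊔ ℓ ⊔ k)
  SamePoint (α , β) (α' , β') = Σ End λ γ → IsUnitE γ × (α' ≈E γ ·E α) × (β' ≈E γ ·E β)

  Distant : (End × End) → (End × End) → Set (c ⊔ ℓ ⊔ k)
  Distant (α , β) (γ , δ) = InGL₂ α β γ δ

  NonzeroPair : Carrier × Carrier → Set ℓ
  NonzeroPair (a , b) = ¬ ((a ≈ 0#) × (b ≈ 0#))

  -- the point E(ρ_a , ρ_b) of PG(1,F) is non-distant to the point T = E(α , β)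
  NonDistF : (End × End) → Carrier × Carrier → Set (c ⊔ ℓ ⊔ k)
  NonDistF T (a , b) = NonzeroPair (a , b) × ¬ Distant (ρ a , ρ b) T

  InL : (End × End) → (End × End) → Set (c ⊔ ℓ ⊔ k)
  InL T P = Σ Carrier λ a → Σ Carrier λ b → NonDistF T (a , b) × SamePoint P (ρ a , ρ b)

  -- T is scattered: |L_T| = θ_{t-1}, points of PG(1,F) counted as points (up to SamePoint)
  Scattered : ℕ → ℕ → (End × End) → Set (c ⊔ ℓ ⊔ k)
  Scattered q t T = HasSizeMod (λ p p' → SamePoint (ρ (proj₁ p) , ρ (proj₂ p)) (ρ (proj₁ p') , ρ (proj₂ p')))
                               (NonDistF T) (θ q t)

  quot : End → (u : Carrier) → ¬ (u ≈ 0#) → Carrier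
  quot β u nz = ap β u * inv u nz

  LinDep : Carrier → Carrier → Set (c ⊔ ℓ ⊔ k)
  LinDep u v = Σ Carrier λ l → Σ Carrier λ m → K l × K m × ¬ ((l ≈ 0#) × (m ≈ 0#))
               × (l * u + m * v ≈ 0#)

  -- the kernel of β has K-dimension at most one: it is spanned by a single vector
  KerDim≤1 : End → Set (c ⊔ ℓ ⊔ k)
  KerDim≤1 β = Σ Carrier λ v → (ap β v ≈ 0#) ×
               (∀ x → ap β x ≈ 0# → Σ Carrier λ l → K l × (x ≈ l * v))

  InI : End → Carrier → Set (c ⊔ ℓ)
  InI β x = Σ Carrier λ u → Σ (¬ (u ≈ 0#)) λ nz → x ≈ quot β u nz

-- The point E(ρ_a, ρ_b) is non-distant to T = E(1, β) exactly when (au)^β = bu for some u ≠ 0: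
-- otherwise x ↦ bx − (ax)^β is injective, hence invertible as F is finite, and an inverse of this
-- Schur complement yields an inverse of the matrix with rows (ρ_a, ρ_b), (1, β).  So L_T consists of
-- the points E(1, ρ_{u^β/u}), which gives (i) and, taking u in the kernel of β, (v); as T is scattered,
-- u ↦ u^β/u takes exactly θ_{t−1} values (ii).  This map is constant on the q − 1 nonzero multiples
-- of u, and if a fibre met two lines then 0 and the nonzero multiples of θ_{t−1} + 1 vectors on
-- distinct lines would be more than 1 + θ_{t−1}(q − 1) = q^t elements of F.  Hence the fibres are the
-- punctured lines (iii), and (iv) is the fibre over 0.
module Submission where

open import Defs
open import Level using (Level; _⊔_)
open import Algebra.Bundles using (CommutativeRing)
import Algebra.Properties.CommutativeSemigroup as CommutativeSemigroupProperties
open import Data.Nat as ℕ using (ℕ; zero; suc; _^_; _∸_; _≤_)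
import Data.Nat.Properties as ℕ
open import Data.Nat.Primality using (Prime)
open import Data.Fin as Fin using (Fin; zero; suc)
import Data.Fin.Properties as Fin
open import Data.List as List using (List)
import Data.List.Properties as List
import Data.List.Relation.Unary.All as All
import Data.List.Relation.Unary.All.Properties as All
open import Data.List.Relation.Unary.AllPairs as AllPairs using (AllPairs)
import Data.List.Relation.Unary.AllPairs.Properties as AllPairs
import Data.List.Relation.Unary.Any as Any
import Data.List.Relation.Unary.Any.Properties as Any
open import Data.List.Membership.Propositional.Properties using (∈-lookup)
open import Data.Product using (Σ; ∃; _×_; _,_; proj₁; proj₂; uncurry)
open import Data.Unit.Polymorphic using (⊤; tt)
open import Data.Vec.Functional using (_∷_)
open import Function.Base using (_∘_)
open import Function.Bundles using (_⇔_; mk⇔; Equivalence)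
open import Function.Construct.Composition using (_⇔-∘_)
open import Relation.Nullary using (¬_; Dec; yes; no; contradiction)
open import Relation.Nullary.Decidable using (¬?; _×-dec_; decidable-stable)
open import Relation.Unary using (Decidable)
open import Relation.Binary.Bundles using (Setoid)
open import Relation.Binary.Definitions using (_Respects_; tri<; tri≈; tri>)
import Relation.Binary.Construct.On as On
import Relation.Binary.Reasoning.Setoid as SetoidReasoning
open import Relation.Binary.PropositionalEquality as ≡ using (_≡_)

AllPairs-lookup : ∀ {a r} {A : Set a} {R : A → A → Set r} {xs : List A} → AllPairs R xs →
                  ∀ {i j} → i Fin.< j → R (List.lookup xs i) (List.lookup xs j)
AllPairs-lookup (Rx AllPairs.∷ _)   {zero}  {suc j} _            = All.lookup Rx (∈-lookup j)
AllPairs-lookup (_  AllPairs.∷ Rxs) {suc i} {suc j} (ℕ.s≤s i<j) = AllPairs-lookup Rxs i<j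

remQuot-injective : ∀ {n} k {i j : Fin (n ℕ.* k)} → Fin.remQuot {n} k i ≡ Fin.remQuot k j → i ≡ j
remQuot-injective {n} k {i} {j} eq = begin
  i                                         ≡⟨ Fin.combine-remQuot {n} k i ⟨
  uncurry Fin.combine (Fin.remQuot {n} k i) ≡⟨ ≡.cong (uncurry Fin.combine) eq ⟩
  uncurry Fin.combine (Fin.remQuot {n} k j) ≡⟨ Fin.combine-remQuot {n} k j ⟩
  j                                         ∎
  where open ≡.≡-Reasoning

module Enumerations {a ℓ} (S : Setoid a ℓ) where
  open Setoid S

  record Enumeration {p} (P : Carrier → Set p) (n : ℕ) : Set (a ⊔ ℓ ⊔ p) where
    field
      enum       : Fin n → Carrier
      enum-P     : ∀ i → P (enum i)
      enum-inj   : ∀ {i j} → enum i ≈ enum j → i ≡ j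
      index      : ∀ x → P x → Fin n
      enum-index : ∀ x (px : P x) → x ≈ enum (index x px)

    search : ∀ {q} {Q : Carrier → Set q} → Decidable Q → Q Respects _≈_ →
             Dec (∃ λ x → P x × Q x)
    search Q? resp with Fin.any? (λ i → Q? (enum i))
    ... | yes (i , Qi) = yes (enum i , enum-P i , Qi)
    ... | no ¬Q        = no λ (x , px , Qx) → ¬Q (index x px , resp (enum-index x px) Qx)

  HasSizeMod⇒Enumeration : ∀ {p} {P : Carrier → Set p} {n} → HasSizeMod _≈_ P n → Enumeration P n
  HasSizeMod⇒Enumeration (xs , ≡.refl , distinct , allP , covers) = record
    { enum       = List.lookup xs
    ; enum-P     = λ i → All.lookup allP (∈-lookup i)
    ; enum-inj   = inj
    ; index      = λ x px → Any.index (covers x px)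
    ; enum-index = λ x px → Any.lookup-index (covers x px)
    }
    where
    inj : ∀ {i j} → List.lookup xs i ≈ List.lookup xs j → i ≡ j
    inj {i} {j} eq with Fin.<-cmp i j
    ... | tri< i<j _ _ = contradiction eq (AllPairs-lookup distinct i<j)
    ... | tri≈ _ i≡j _ = i≡j
    ... | tri> _ _ j<i = contradiction (sym eq) (AllPairs-lookup distinct j<i)

  module _ {p} {P : Carrier → Set p} where

    Enumeration⇒HasSizeMod : ∀ {n} → Enumeration P n → HasSizeMod _≈_ P n
    Enumeration⇒HasSizeMod {n} E = List.tabulate enum , List.length-tabulate enum
      , AllPairs.tabulate⁺ (λ i≢j eq → i≢j (enum-inj eq)) , All.tabulate⁺ enum-P
      , λ x px → Any.tabulate⁺ (index x px) (enum-index x px)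
      where open Enumeration E

    without : ∀ {n x₀} → Enumeration P n → P x₀ → Enumeration (λ x → P x × ¬ x ≈ x₀) (n ∸ 1)
    without {zero}  {x₀} E px₀ = contradiction (Enumeration.index E x₀ px₀) Fin.¬Fin0
    without {suc n} {x₀} E px₀ = record
      { enum       = λ i → enum (Fin.punchIn i₀ i)
      ; enum-P     = λ i → enum-P _ , λ eq → Fin.punchInᵢ≢i i₀ i (enum-inj (trans eq (enum-index x₀ px₀)))
      ; enum-inj   = λ eq → Fin.punchIn-injective i₀ _ _ (enum-inj eq)
      ; index      = λ x (px , x≉x₀) → Fin.punchOut (i₀≢index px x≉x₀)
      ; enum-index = λ x (px , x≉x₀) →
          trans (enum-index x px) (reflexive (≡.cong enum (≡.sym (Fin.punchIn-punchOut (i₀≢index px x≉x₀)))))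
      }
      where
      open Enumeration E
      i₀ = index x₀ px₀
      i₀≢index : ∀ {x} (px : P x) → ¬ x ≈ x₀ → ¬ i₀ ≡ index x px
      i₀≢index {x} px x≉x₀ i₀≡ix =
        x≉x₀ (trans (enum-index x px) (trans (reflexive (≡.cong enum (≡.sym i₀≡ix))) (sym (enum-index x₀ px₀))))

  module Finite {p n} (E : Enumeration (λ _ → ⊤ {p}) n) where
    open Enumeration E

    index-≈ : ∀ x → x ≈ enum (index x tt)
    index-≈ x = enum-index x tt

    infix 4 _≟_
    _≟_ : ∀ x y → Dec (x ≈ y)
    x ≟ y with index x tt Fin.≟ index y tt
    ... | yes eq = yes (trans (index-≈ x) (trans (reflexive (≡.cong enum eq)) (sym (index-≈ y))))
    ... | no neq = no λ x≈y → neq (enum-inj (trans (sym (index-≈ x)) (trans x≈y (index-≈ y))))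

    ∃? : ∀ {q} {Q : Carrier → Set q} → Decidable Q → Q Respects _≈_ → Dec (∃ Q)
    ∃? Q? resp with search Q? resp
    ... | yes (x , _ , Qx) = yes (x , Qx)
    ... | no ¬Q            = no λ (x , Qx) → ¬Q (x , tt , Qx)

    injection⇒≤ : ∀ {m} (f : Fin m → Carrier) → (∀ {i j} → f i ≈ f j → i ≡ j) → m ℕ.≤ n
    injection⇒≤ {m} f f-inj with m ℕ.≤? n
    ... | yes m≤n = m≤n
    ... | no  m≰n with Fin.pigeonhole (ℕ.≰⇒> m≰n) (λ i → index (f i) tt)
    ...   | i , j , i<j , same = contradiction (f-inj f≈) (Fin.<⇒≢ i<j)
      where
      f≈ : f i ≈ f j
      f≈ = trans (index-≈ (f i)) (trans (reflexive (≡.cong enum same)) (sym (index-≈ (f j))))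

    injective⇒surjective : (f : Carrier → Carrier) → (∀ {x y} → f x ≈ f y → x ≈ y) →
                           ∀ y → ∃ λ x → f x ≈ y
    injective⇒surjective f f-inj y with Fin.any? (λ i → f (enum i) ≟ y)
    ... | yes (i , fi≈y) = enum i , fi≈y
    ... | no  y∉image    = contradiction (injection⇒≤ g g-inj) ℕ.1+n≰n
      where
      g : Fin (suc n) → Carrier
      g zero    = y
      g (suc i) = f (enum i)

      g-inj : ∀ {i j} → g i ≈ g j → i ≡ j
      g-inj {zero}  {zero}  _  = ≡.refl
      g-inj {zero}  {suc j} eq = contradiction (j , sym eq) y∉image
      g-inj {suc i} {zero}  eq = contradiction (i , eq) y∉image
      g-inj {suc i} {suc j} eq = ≡.cong suc (enum-inj (f-inj eq))

module _ where
  open import Data.Nat using (_*_)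
  open import Data.Nat.DivMod using (_/_; m*n/n≡m)
  open import Data.Nat.Tactic.RingSolver using (solve-∀)

  private
    pow-form : ∀ k t → ∃ λ d → suc (suc k) ^ t ≡ suc (d * suc k)
    pow-form k zero    = 0 , ≡.refl
    pow-form k (suc t) with d , eq ← pow-form k t =
      suc (suc (suc k) * d) , ≡.trans (≡.cong (suc (suc k) *_) eq) (step k d)
      where
      step : ∀ k d → suc (suc k) * suc (d * suc k) ≡ suc (suc (suc (suc k) * d) * suc k)
      step = solve-∀

  q^t≡1+θ*[q∸1] : ∀ q t → .{{ℕ.NonZero q}} → q ^ t ≡ suc (θ q t * (q ∸ 1))
  q^t≡1+θ*[q∸1] (suc zero)    t = ℕ.^-zeroˡ t
  q^t≡1+θ*[q∸1] (suc (suc k)) t with d , eq ← pow-form k t =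
    ≡.trans eq (≡.cong (λ e → suc (e * suc k)) (≡.sym θ≡d))
    where
    θ≡d : θ (suc (suc k)) t ≡ d
    θ≡d = ≡.trans (≡.cong (λ e → (e ∸ 1) / suc k) eq) (m*n/n≡m d (suc k))

module FieldProperties {c ℓ} (R : CommutativeRing c ℓ) (Fs : FieldStr R) where
  open CommutativeRing R
  open FieldStr Fs
  open CommutativeSemigroupProperties *-commutativeSemigroup using (x∙yz≈zy∙x; xy∙z≈xz∙y)
  open SetoidReasoning setoid

  1≉0 : ¬ 1# ≈ 0#
  1≉0 1≈0 = 0≉1 (sym 1≈0)

  x⁻¹*x≈1 : ∀ x (x≉0 : ¬ x ≈ 0#) → inv x x≉0 * x ≈ 1#
  x⁻¹*x≈1 x x≉0 = trans (*-comm _ _) (inv-r x x≉0)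

  x⁻¹*[x*y]≈y : ∀ {x} (x≉0 : ¬ x ≈ 0#) y → inv x x≉0 * (x * y) ≈ y
  x⁻¹*[x*y]≈y {x} x≉0 y = begin
    inv x x≉0 * (x * y) ≈⟨ *-assoc _ _ _ ⟨
    inv x x≉0 * x * y   ≈⟨ *-congʳ (x⁻¹*x≈1 x x≉0) ⟩
    1# * y              ≈⟨ *-identityˡ y ⟩
    y                   ∎

  x*[x⁻¹*y]≈y : ∀ {x} (x≉0 : ¬ x ≈ 0#) y → x * (inv x x≉0 * y) ≈ y
  x*[x⁻¹*y]≈y {x} x≉0 y = begin
    x * (inv x x≉0 * y)  ≈⟨ *-assoc _ _ _ ⟨
    x * inv x x≉0 * y    ≈⟨ *-congʳ (inv-r x x≉0) ⟩
    1# * y               ≈⟨ *-identityˡ y ⟩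
    y                    ∎

  x⁻¹≉0 : ∀ x (x≉0 : ¬ x ≈ 0#) → ¬ inv x x≉0 ≈ 0#
  x⁻¹≉0 x x≉0 x⁻¹≈0 = 1≉0 (trans (sym (inv-r x x≉0)) (trans (*-congˡ x⁻¹≈0) (zeroʳ x)))

  *-cancelˡ : ∀ {x y z} → ¬ x ≈ 0# → x * y ≈ x * z → y ≈ z
  *-cancelˡ {y = y} {z} x≉0 eq =
    trans (sym (x⁻¹*[x*y]≈y x≉0 y)) (trans (*-congˡ eq) (x⁻¹*[x*y]≈y x≉0 z))

  *-cancelʳ : ∀ {x y z} → ¬ x ≈ 0# → y * x ≈ z * x → y ≈ z
  *-cancelʳ x≉0 eq = *-cancelˡ x≉0 (trans (*-comm _ _) (trans eq (*-comm _ _)))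

  x*y≈0⇒y≈0 : ∀ {x y} → ¬ x ≈ 0# → x * y ≈ 0# → y ≈ 0#
  x*y≈0⇒y≈0 {x} x≉0 eq = *-cancelˡ x≉0 (trans eq (sym (zeroʳ x)))

  x≉0∧y≉0⇒x*y≉0 : ∀ {x y} → ¬ x ≈ 0# → ¬ y ≈ 0# → ¬ x * y ≈ 0#
  x≉0∧y≉0⇒x*y≉0 x≉0 y≉0 xy≈0 = y≉0 (x*y≈0⇒y≈0 x≉0 xy≈0)

  x*y⁻¹≈z⇔x≈z*y : ∀ {x y z} (y≉0 : ¬ y ≈ 0#) → (x * inv y y≉0 ≈ z) ⇔ (x ≈ z * y)
  x*y⁻¹≈z⇔x≈z*y {x} {y} {z} y≉0 = mk⇔ to from
    where
    to : x * inv y y≉0 ≈ z → x ≈ z * y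
    to eq = begin
      x                      ≈⟨ x⁻¹*[x*y]≈y y≉0 x ⟨
      inv y y≉0 * (y * x)    ≈⟨ x∙yz≈zy∙x _ _ _ ⟩
      x * y * inv y y≉0      ≈⟨ xy∙z≈xz∙y _ _ _ ⟩
      x * inv y y≉0 * y      ≈⟨ *-congʳ eq ⟩
      z * y                  ∎
    from : x ≈ z * y → x * inv y y≉0 ≈ z
    from eq = begin
      x * inv y y≉0          ≈⟨ *-congʳ eq ⟩
      z * y * inv y y≉0      ≈⟨ *-assoc _ _ _ ⟩
      z * (y * inv y y≉0)    ≈⟨ *-congˡ (inv-r y y≉0) ⟩
      z * 1#                 ≈⟨ *-identityʳ z ⟩
      z                      ∎

module LinearAlgebra {c ℓ k} (R : CommutativeRing c ℓ) (Fs : FieldStr R)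
                  (K : CommutativeRing.Carrier R → Set k) (KS : IsSubfield R Fs K) where
  open CommutativeRing R
  open FieldStr Fs
  open IsSubfield KS
  open Setup R Fs K
  open FieldProperties R Fs
  open import Algebra.Properties.Group +-group using (inverseˡ-unique; inverseʳ-unique; x∙y⁻¹≈ε⇒x≈y)
  open import Algebra.Properties.AbelianGroup +-abelianGroup using (⁻¹-∙-comm)
  open import Algebra.Properties.Ring ring using (-‿distribʳ-*; -‿distribˡ-*)
  open CommutativeSemigroupProperties *-commutativeSemigroup using (x∙yz≈y∙xz)
  open SetoidReasoning setoid

  ap-0 : ∀ α → ap α 0# ≈ 0#
  ap-0 α = begin
    ap α 0#          ≈⟨ ap-cong α (zeroˡ 0#) ⟨
    ap α (0# * 0#)   ≈⟨ homog α 0# 0# K-0 ⟩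
    0# * ap α 0#     ≈⟨ zeroˡ _ ⟩
    0#               ∎

  ap-neg : ∀ α x → ap α (- x) ≈ - ap α x
  ap-neg α x = inverseʳ-unique (ap α x) (ap α (- x)) (begin
    ap α x + ap α (- x) ≈⟨ additive α x (- x) ⟨
    ap α (x + - x)      ≈⟨ ap-cong α (-‿inverseʳ x) ⟩
    ap α 0#             ≈⟨ ap-0 α ⟩
    0#                  ∎)

  trivial-kernel⇒injective : ∀ α → (∀ x → ap α x ≈ 0# → x ≈ 0#) →
                             ∀ {x y} → ap α x ≈ ap α y → x ≈ y
  trivial-kernel⇒injective α ker {x} {y} eq = x∙y⁻¹≈ε⇒x≈y x y (ker (x + - y) (begin
    ap α (x + - y)       ≈⟨ additive α x (- y) ⟩
    ap α x + ap α (- y)  ≈⟨ +-cong eq (ap-neg α y) ⟩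
    ap α y + - ap α y    ≈⟨ -‿inverseʳ _ ⟩
    0#                   ∎))

  ρ-unit : ∀ {x} → ¬ x ≈ 0# → IsUnitE (ρ x)
  ρ-unit x≉0 = ρ (inv _ x≉0) , x⁻¹*[x*y]≈y x≉0 , x*[x⁻¹*y]≈y x≉0

  infix 8 -E_
  -E_ : End → End
  -E α = record
    { ap       = λ x → - ap α x
    ; ap-cong  = λ x≈y → -‿cong (ap-cong α x≈y)
    ; additive = λ x y → trans (-‿cong (additive α x y)) (sym (⁻¹-∙-comm _ _))
    ; homog    = λ a x a∈K → trans (-‿cong (homog α a x a∈K)) (-‿distribʳ-* a _)
    }

  Singular : End → Set (c ⊔ ℓ)
  Singular α = ∃ λ u → ¬ u ≈ 0# × ap α u ≈ 0#

  unit⇒¬singular : ∀ {α} → IsUnitE α → ¬ Singular α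
  unit⇒¬singular {α} (γ , αγ≈1 , _) (u , u≉0 , αu≈0) = u≉0 (begin
    u              ≈⟨ αγ≈1 u ⟨
    ap γ (ap α u)  ≈⟨ ap-cong γ αu≈0 ⟩
    ap γ 0#        ≈⟨ ap-0 γ ⟩
    0#             ∎)

  infix 4 _∈⟨_⟩
  _∈⟨_⟩ : Carrier → Carrier → Set (c ⊔ ℓ ⊔ k)
  u ∈⟨ v ⟩ = ∃ λ x → K x × u ≈ x * v

  scaled≈⇒∈⟨⟩ : ∀ {x y u v} → K x → K y → ¬ x ≈ 0# → x * u ≈ y * v → u ∈⟨ v ⟩
  scaled≈⇒∈⟨⟩ {x} {y} {u} {v} x∈K y∈K x≉0 xu≈yv = inv x x≉0 * y , K-* (K-inv x≉0 x∈K) y∈K , (begin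
    u                       ≈⟨ x⁻¹*[x*y]≈y x≉0 u ⟨
    inv x x≉0 * (x * u)     ≈⟨ *-congˡ xu≈yv ⟩
    inv x x≉0 * (y * v)     ≈⟨ *-assoc _ _ _ ⟨
    inv x x≉0 * y * v       ∎)

  ≈0⇒∈⟨⟩ : ∀ {u v} → u ≈ 0# → u ∈⟨ v ⟩
  ≈0⇒∈⟨⟩ {v = v} u≈0 = 0# , K-0 , trans u≈0 (sym (zeroˡ v))

  ∈⟨⟩-sym : ∀ {u v} → ¬ u ≈ 0# → u ∈⟨ v ⟩ → v ∈⟨ u ⟩
  ∈⟨⟩-sym {u} {v} u≉0 (x , x∈K , u≈xv) =
    scaled≈⇒∈⟨⟩ x∈K K-1 x≉0 (trans (sym u≈xv) (sym (*-identityˡ u)))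
    where
    x≉0 : ¬ x ≈ 0#
    x≉0 x≈0 = u≉0 (trans u≈xv (trans (*-congʳ x≈0) (zeroˡ v)))

  ∈⟨⟩-trans : ∀ {u v w} → u ∈⟨ v ⟩ → v ∈⟨ w ⟩ → u ∈⟨ w ⟩
  ∈⟨⟩-trans {u} {v} {w} (x , x∈K , u≈xv) (y , y∈K , v≈yw) =
    x * y , K-* x∈K y∈K , trans u≈xv (trans (*-congˡ v≈yw) (sym (*-assoc x y w)))

  LinDep⇔∈⟨⟩ : ∀ {u v} → ¬ v ≈ 0# → LinDep u v ⇔ u ∈⟨ v ⟩
  LinDep⇔∈⟨⟩ {u} {v} v≉0 = mk⇔ to from
    where
    to : LinDep u v → u ∈⟨ v ⟩
    to (l , m , l∈K , m∈K , ¬both≈0 , lu+mv≈0) = - (l⁻¹ * m) , K-neg (K-* (K-inv l≉0 l∈K) m∈K) , (begin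
      u                     ≈⟨ x⁻¹*[x*y]≈y l≉0 u ⟨
      l⁻¹ * (l * u)         ≈⟨ *-congˡ (inverseˡ-unique _ _ lu+mv≈0) ⟩
      l⁻¹ * - (m * v)       ≈⟨ -‿distribʳ-* _ _ ⟨
      - (l⁻¹ * (m * v))     ≈⟨ -‿cong (*-assoc _ _ _) ⟨
      - (l⁻¹ * m * v)       ≈⟨ -‿distribˡ-* _ _ ⟩
      - (l⁻¹ * m) * v       ∎)
      where
      l≉0 : ¬ l ≈ 0#
      l≉0 l≈0 = ¬both≈0 (l≈0 , x*y≈0⇒y≈0 v≉0 (trans (*-comm v m) (begin
        m * v            ≈⟨ +-identityˡ _ ⟨
        0# + m * v       ≈⟨ +-congʳ (trans (*-congʳ l≈0) (zeroˡ u)) ⟨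
        l * u + m * v    ≈⟨ lu+mv≈0 ⟩
        0#               ∎)))
      l⁻¹ = inv l l≉0
    from : u ∈⟨ v ⟩ → LinDep u v
    from (x , x∈K , u≈xv) = 1# , - x , K-1 , K-neg x∈K , 1≉0 ∘ proj₁ , (begin
      1# * u + - x * v     ≈⟨ +-cong (*-identityˡ u) (sym (-‿distribˡ-* x v)) ⟩
      u + - (x * v)        ≈⟨ +-congʳ u≈xv ⟩
      x * v + - (x * v)    ≈⟨ -‿inverseʳ _ ⟩
      0#                   ∎)

  quot-* : ∀ α {w} (w≉0 : ¬ w ≈ 0#) → quot α w w≉0 * w ≈ ap α w
  quot-* α w≉0 = sym (Equivalence.to (x*y⁻¹≈z⇔x≈z*y w≉0) refl)

  quot-unique : ∀ α {w r} (w≉0 : ¬ w ≈ 0#) → r * w ≈ ap α w → quot α w w≉0 ≈ r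
  quot-unique α w≉0 rw≈αw = Equivalence.from (x*y⁻¹≈z⇔x≈z*y w≉0) (sym rw≈αw)

  quot≈0 : ∀ α {w} (w≉0 : ¬ w ≈ 0#) → ap α w ≈ 0# → quot α w w≉0 ≈ 0#
  quot≈0 α {w} w≉0 αw≈0 = quot-unique α w≉0 (trans (zeroˡ w) (sym αw≈0))

  ∈⟨⟩⇒quot≈ : ∀ α {u v} (u≉0 : ¬ u ≈ 0#) (v≉0 : ¬ v ≈ 0#) → u ∈⟨ v ⟩ → quot α u u≉0 ≈ quot α v v≉0
  ∈⟨⟩⇒quot≈ α {u} {v} u≉0 v≉0 (x , x∈K , u≈xv) = quot-unique α u≉0 (begin
    quot α v v≉0 * u          ≈⟨ *-congˡ u≈xv ⟩
    quot α v v≉0 * (x * v)    ≈⟨ x∙yz≈y∙xz _ _ _ ⟩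
    x * (quot α v v≉0 * v)    ≈⟨ *-congˡ (quot-* α v≉0) ⟩
    x * ap α v                ≈⟨ homog α x v x∈K ⟨
    ap α (x * v)              ≈⟨ ap-cong α u≈xv ⟨
    ap α u                    ∎)

  module OverFiniteField {n} (EF : Enumerations.Enumeration setoid (λ _ → ⊤ {k}) n) where
    open Enumerations setoid using (Enumeration)
    open Enumerations.Finite setoid EF

    injective⇒unit : ∀ α → (∀ {x y} → ap α x ≈ ap α y → x ≈ y) → IsUnitE α
    injective⇒unit α α-inj = γ , (λ x → α-inj (αγ (ap α x))) , αγ
      where
      γ-ap : Carrier → Carrier
      γ-ap y = proj₁ (injective⇒surjective (ap α) α-inj y)
      αγ : ∀ y → ap α (γ-ap y) ≈ y
      αγ y = proj₂ (injective⇒surjective (ap α) α-inj y)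
      γ : End
      γ = record
        { ap       = γ-ap
        ; ap-cong  = λ {x} {y} x≈y → α-inj (trans (αγ x) (trans x≈y (sym (αγ y))))
        ; additive = λ x y → α-inj (begin
            ap α (γ-ap (x + y))            ≈⟨ αγ (x + y) ⟩
            x + y                          ≈⟨ +-cong (αγ x) (αγ y) ⟨
            ap α (γ-ap x) + ap α (γ-ap y)  ≈⟨ additive α _ _ ⟨
            ap α (γ-ap x + γ-ap y)         ∎)
        ; homog    = λ a x a∈K → α-inj (begin
            ap α (γ-ap (a * x))            ≈⟨ αγ (a * x) ⟩
            a * x                          ≈⟨ *-congˡ (αγ x) ⟨
            a * ap α (γ-ap x)              ≈⟨ homog α a _ a∈K ⟨
            ap α (a * γ-ap x)              ∎)
        }

    singular? : ∀ α → Dec (Singular α)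
    singular? α = ∃? (λ u → ¬? (u ≟ 0#) ×-dec (ap α u ≟ 0#))
                     (λ x≈y (x≉0 , αx≈0) → (λ y≈0 → x≉0 (trans x≈y y≈0)) , trans (ap-cong α (sym x≈y)) αx≈0)

    ¬singular⇒unit : ∀ α → ¬ Singular α → IsUnitE α
    ¬singular⇒unit α ¬sing = injective⇒unit α (trivial-kernel⇒injective α λ x αx≈0 →
      decidable-stable (x ≟ 0#) (λ x≉0 → ¬sing (x , x≉0 , αx≈0)))

    ¬unit⇔singular : ∀ α → (¬ IsUnitE α) ⇔ Singular α
    ¬unit⇔singular α = mk⇔
      (λ ¬unit → decidable-stable (singular? α) (¬unit ∘ ¬singular⇒unit α))
      (λ sing unit → unit⇒¬singular {α} unit sing)

    -- 0 and the nonzero K-multiples of the W i are pairwise distinct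
    distinct-lines-bound : ∀ {m} → Enumeration (λ x → K x × ¬ x ≈ 0#) m →
                           ∀ {M} (W : Fin M → Carrier) → (∀ i → ¬ W i ≈ 0#) →
                           (∀ {i j} → W i ∈⟨ W j ⟩ → i ≡ j) → suc (M ℕ.* m) ≤ n
    distinct-lines-bound {m} K* {M} W W≉0 W-distinct = injection⇒≤ f f-inj
      where
      open Enumeration K* renaming (enum to κ; enum-P to κ-P; enum-inj to κ-inj)

      point : Fin M × Fin m → Carrier
      point (i , j) = κ j * W i

      point≉0 : ∀ p → ¬ point p ≈ 0#
      point≉0 (i , j) = x≉0∧y≉0⇒x*y≉0 (proj₂ (κ-P j)) (W≉0 i)

      point-inj : ∀ {p p'} → point p ≈ point p' → p ≡ p'
      point-inj {i , j} {i' , j'} eq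
        with ≡.refl ← W-distinct (scaled≈⇒∈⟨⟩ (proj₁ (κ-P j)) (proj₁ (κ-P j')) (proj₂ (κ-P j)) eq) =
        ≡.cong (i ,_) (κ-inj (*-cancelʳ (W≉0 i) eq))

      f : Fin (suc (M ℕ.* m)) → Carrier
      f zero    = 0#
      f (suc i) = point (Fin.remQuot {M} m i)

      f-inj : ∀ {i j} → f i ≈ f j → i ≡ j
      f-inj {zero}  {zero}  _  = ≡.refl
      f-inj {zero}  {suc j} eq = contradiction (sym eq) (point≉0 _)
      f-inj {suc i} {zero}  eq = contradiction eq (point≉0 _)
      f-inj {suc i} {suc j} eq = ≡.cong suc (remQuot-injective {M} m (point-inj eq))

module DistanceCriterion {c ℓ k} (R : CommutativeRing c ℓ) (Fs : FieldStr R)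
                         (K : CommutativeRing.Carrier R → Set k) (KS : IsSubfield R Fs K)
                         (β : Setup.End R Fs K) where
  open CommutativeRing R
  open Setup R Fs K
  open LinearAlgebra R Fs K KS hiding (module OverFiniteField)
  open import Algebra.Properties.Group +-group
    using (//-rightDividesˡ; //-rightDividesʳ; \\-leftDividesʳ; x∙y⁻¹≈ε⇒x≈y)
  open import Algebra.Properties.Ring ring using (-‿distribʳ-*)
  open SetoidReasoning setoid

  NonDistanceWitness : Carrier → Carrier → Set (c ⊔ ℓ)
  NonDistanceWitness a b = ∃ λ u → ¬ u ≈ 0# × ap β (a * u) ≈ b * u

  witness⇒¬distant : ∀ {a b} → NonDistanceWitness a b → ¬ Distant (ρ a , ρ b) (1E , β)
  witness⇒¬distant {a} {b} (u , u≉0 , βau≈bu) (a' , _ , c' , _ , (MN₁₁ , _ , MN₂₁ , _) , _) =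
    u≉0 (begin
      u                                    ≈⟨ MN₁₁ u ⟨
      ap a' (a * u) + ap c' (b * u)        ≈⟨ +-congˡ (ap-cong c' βau≈bu) ⟨
      ap a' (a * u) + ap c' (ap β (a * u)) ≈⟨ MN₂₁ (a * u) ⟩
      0#                                   ∎)

  -- x ↦ b x - (a x)^β, the Schur complement of the entry 1 in the matrix with rows (ρ_a, ρ_b), (1, β)
  schur : Carrier → Carrier → End
  schur a b = ρ b +E -E (ρ a ·E β)

  schur-unit⇒distant : ∀ {a b} → IsUnitE (schur a b) → Distant (ρ a , ρ b) (1E , β)
  schur-unit⇒distant {a} {b} (γ , γ-left , γ-right) =
    -E (β ·E γ) , 1E +E β ·E γ ·E ρ a , γ , -E (γ ·E ρ a) ,
    (MN₁₁ , MN₁₂ , MN₂₁ , MN₂₂) , (NM₁₁ , NM₁₂ , NM₂₁ , NM₂₂)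
    where
    g = ap γ

    g[bx] : ∀ x → g (b * x) ≈ x + g (ap β (a * x))
    g[bx] x = begin
      g (b * x)                                          ≈⟨ ap-cong γ (//-rightDividesˡ _ _) ⟨
      g ((b * x + - ap β (a * x)) + ap β (a * x))        ≈⟨ additive γ _ _ ⟩
      g (b * x + - ap β (a * x)) + g (ap β (a * x))      ≈⟨ +-congʳ (γ-left x) ⟩
      x + g (ap β (a * x))                               ∎

    MN₁₁ : ∀ x → - g (ap β (a * x)) + g (b * x) ≈ x
    MN₁₁ x = begin
      - g (ap β (a * x)) + g (b * x)   ≈⟨ +-congʳ (ap-neg γ _) ⟨
      g (- ap β (a * x)) + g (b * x)   ≈⟨ additive γ _ _ ⟨
      g (- ap β (a * x) + b * x)       ≈⟨ ap-cong γ (+-comm _ _) ⟩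
      g (b * x + - ap β (a * x))       ≈⟨ γ-left x ⟩
      x                                ∎

    MN₁₂ : ∀ x → (a * x + a * g (ap β (a * x))) + - (a * g (b * x)) ≈ 0#
    MN₁₂ x = trans (+-cong (sym (distribˡ a _ _)) (-‿cong (*-congˡ (g[bx] x)))) (-‿inverseʳ _)

    MN₂₁ : ∀ x → - g (ap β x) + g (ap β x) ≈ 0#
    MN₂₁ x = -‿inverseˡ _

    MN₂₂ : ∀ x → (x + a * g (ap β x)) + - (a * g (ap β x)) ≈ x
    MN₂₂ x = //-rightDividesʳ _ _

    NM₁₁ : ∀ x → a * - g (ap β x) + (x + a * g (ap β x)) ≈ x
    NM₁₁ x = trans (+-cong (sym (-‿distribʳ-* a _)) (+-comm _ _)) (\\-leftDividesʳ _ _)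

    NM₁₂ : ∀ x → b * - g (ap β x) + ap β (x + a * g (ap β x)) ≈ 0#
    NM₁₂ x = let y = g (ap β x) in begin
      b * - y + ap β (x + a * y)                          ≈⟨ +-cong (sym (-‿distribʳ-* b y)) (additive β _ _) ⟩
      - (b * y) + (ap β x + ap β (a * y))                 ≈⟨ +-congˡ (+-congʳ (γ-right (ap β x))) ⟨
      - (b * y) + ((b * y + - ap β (a * y)) + ap β (a * y)) ≈⟨ +-congˡ (//-rightDividesˡ _ _) ⟩
      - (b * y) + b * y                                   ≈⟨ -‿inverseˡ _ ⟩
      0#                                                  ∎

    NM₂₁ : ∀ x → a * g x + - (a * g x) ≈ 0#
    NM₂₁ x = -‿inverseʳ _

    NM₂₂ : ∀ x → b * g x + ap β (- (a * g x)) ≈ x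
    NM₂₂ x = trans (+-congˡ (ap-neg β _)) (γ-right x)

  singular-schur⇒witness : ∀ {a b} → Singular (schur a b) → NonDistanceWitness a b
  singular-schur⇒witness (u , u≉0 , su≈0) = u , u≉0 , sym (x∙y⁻¹≈ε⇒x≈y _ _ su≈0)

  module OverFiniteField {n} (EF : Enumerations.Enumeration setoid (λ _ → ⊤ {k}) n) where
    open LinearAlgebra.OverFiniteField R Fs K KS EF

    ¬distant⇒witness : ∀ {a b} → ¬ Distant (ρ a , ρ b) (1E , β) → NonDistanceWitness a b
    ¬distant⇒witness {a} {b} ¬distant =
      singular-schur⇒witness (Equivalence.to (¬unit⇔singular (schur a b)) (¬distant ∘ schur-unit⇒distant))

module PointsOfProjectiveLine {c ℓ k} (R : CommutativeRing c ℓ) (Fs : FieldStr R)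
                              (K : CommutativeRing.Carrier R → Set k) (KS : IsSubfield R Fs K) where
  open CommutativeRing R
  open FieldStr Fs
  open Setup R Fs K
  open FieldProperties R Fs
  open LinearAlgebra R Fs K KS hiding (module OverFiniteField)
  open SetoidReasoning setoid

  SamePoint-≈E : ∀ α β α' β' → α ≈E α' → β ≈E β' → SamePoint (α , β) (α' , β')
  SamePoint-≈E _ _ _ _ α≈α' β≈β' = 1E , (1E , (λ _ → refl) , (λ _ → refl)) , sym ∘ α≈α' , sym ∘ β≈β'

  SamePoint-sym : ∀ {P Q} → SamePoint P Q → SamePoint Q P
  SamePoint-sym {α , β} {α' , β'} (γ , (δ , δ-left , δ-right) , α'≈γα , β'≈γβ) =
    δ , (γ , δ-right , δ-left) , back α α' α'≈γα , back β β' β'≈γβ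
    where
    back : ∀ α α' → α' ≈E γ ·E α → α ≈E δ ·E α'
    back α α' α'≈γα x = trans (ap-cong α (sym (δ-right x))) (sym (α'≈γα (ap δ x)))

  SamePoint-trans : ∀ {P Q S} → SamePoint P Q → SamePoint Q S → SamePoint P S
  SamePoint-trans {α , β} {α' , β'} {α'' , β''}
                  (γ , (δ , γδ , δγ) , α'≈γα , β'≈γβ) (γ' , (δ' , γδ' , δγ') , α''≈γα' , β''≈γβ') =
    γ' ·E γ , (δ ·E δ' , (λ x → trans (ap-cong δ' (γδ (ap γ' x))) (γδ' x))
                       , (λ x → trans (ap-cong γ (δγ' (ap δ x))) (δγ x)))
    , (λ x → trans (α''≈γα' x) (α'≈γα (ap γ' x))) , (λ x → trans (β''≈γβ' x) (β'≈γβ (ap γ' x)))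

  SamePoint-ρ⇔ : ∀ {a b a' b' r r'} → ¬ a ≈ 0# → ¬ a' ≈ 0# → b ≈ r * a → b' ≈ r' * a' →
                 SamePoint (ρ a , ρ b) (ρ a' , ρ b') ⇔ r ≈ r'
  SamePoint-ρ⇔ {a} {b} {a'} {b'} {r} {r'} a≉0 a'≉0 b≈ra b'≈r'a' = mk⇔ to from
    where
    to : SamePoint (ρ a , ρ b) (ρ a' , ρ b') → r ≈ r'
    to (γ , _ , a'x≈aγx , b'x≈bγx) = *-cancelʳ a'≉0 (begin
      r * a'                 ≈⟨ *-congˡ (trans (sym (*-identityʳ a')) (a'x≈aγx 1#)) ⟩
      r * (a * ap γ 1#)      ≈⟨ *-assoc _ _ _ ⟨
      r * a * ap γ 1#        ≈⟨ *-congʳ b≈ra ⟨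
      b * ap γ 1#            ≈⟨ trans (sym (*-identityʳ b')) (b'x≈bγx 1#) ⟨
      b'                     ≈⟨ b'≈r'a' ⟩
      r' * a'                ∎)
    from : r ≈ r' → SamePoint (ρ a , ρ b) (ρ a' , ρ b')
    from r≈r' = ρ s , ρ-unit s≉0 , a'x≈asx , b'x≈bsx
      where
      s = inv a a≉0 * a'
      s≉0 : ¬ s ≈ 0#
      s≉0 = x≉0∧y≉0⇒x*y≉0 (x⁻¹≉0 a a≉0) a'≉0
      a'x≈asx : ∀ x → a' * x ≈ a * (s * x)
      a'x≈asx x = begin
        a' * x                      ≈⟨ x*[x⁻¹*y]≈y a≉0 _ ⟨
        a * (inv a a≉0 * (a' * x))  ≈⟨ *-congˡ (*-assoc _ _ _) ⟨
        a * (s * x)                 ∎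
      b'x≈bsx : ∀ x → b' * x ≈ b * (s * x)
      b'x≈bsx x = begin
        b' * x             ≈⟨ *-congʳ (trans b'≈r'a' (*-congʳ (sym r≈r'))) ⟩
        r * a' * x         ≈⟨ *-assoc _ _ _ ⟩
        r * (a' * x)       ≈⟨ *-congˡ (a'x≈asx x) ⟩
        r * (a * (s * x))  ≈⟨ *-assoc _ _ _ ⟨
        r * a * (s * x)    ≈⟨ *-congʳ b≈ra ⟨
        b * (s * x)        ∎

  SamePoint-ρ1⇔ : ∀ {r r'} → SamePoint (ρ 1# , ρ r) (ρ 1# , ρ r') ⇔ r ≈ r'
  SamePoint-ρ1⇔ = SamePoint-ρ⇔ 1≉0 1≉0 (sym (*-identityʳ _)) (sym (*-identityʳ _))

  SamePoint-ρ1 : ∀ δ → SamePoint (ρ 1# , δ) (1E , δ)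
  SamePoint-ρ1 δ = SamePoint-≈E (ρ 1#) δ 1E δ *-identityˡ (λ _ → refl)

  pointsE : Setoid (c ⊔ ℓ ⊔ k) (c ⊔ ℓ ⊔ k)
  pointsE = record
    { Carrier       = End × End
    ; _≈_           = SamePoint
    ; isEquivalence = record
      { refl  = λ {(α , β)} → SamePoint-≈E α β α β (λ _ → refl) (λ _ → refl)
      ; sym   = λ {P Q} → SamePoint-sym {P} {Q}
      ; trans = λ {P Q S} → SamePoint-trans {P} {Q} {S}
      }
    }

  ρ² : Carrier × Carrier → End × End
  ρ² (a , b) = ρ a , ρ b

  pointsF : Setoid c (c ⊔ ℓ ⊔ k)
  pointsF = On.setoid pointsE ρ²

module NonDistantPoints {c ℓ k} (R : CommutativeRing c ℓ) (Fs : FieldStr R)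
                        (K : CommutativeRing.Carrier R → Set k) (KS : IsSubfield R Fs K)
                        {n} (EF : Enumerations.Enumeration (CommutativeRing.setoid R) (λ _ → ⊤ {k}) n)
                        (β : Setup.End R Fs K) where
  open CommutativeRing R
  open Setup R Fs K
  open FieldProperties R Fs
  open LinearAlgebra R Fs K KS hiding (module OverFiniteField)
  open LinearAlgebra.OverFiniteField R Fs K KS EF using (¬unit⇔singular)
  open PointsOfProjectiveLine R Fs K KS
  open DistanceCriterion R Fs K KS β hiding (module OverFiniteField)
  open DistanceCriterion.OverFiniteField R Fs K KS β EF

  T : End × End
  T = 1E , β

  witness⇒a≉0 : ∀ {a b} → NonzeroPair (a , b) → NonDistanceWitness a b → ¬ a ≈ 0#
  witness⇒a≉0 {a} {b} ab≉0 (u , u≉0 , βau≈bu) a≈0 = ab≉0 (a≈0 , x*y≈0⇒y≈0 u≉0 (trans (*-comm u b) (begin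
    b * u           ≈⟨ βau≈bu ⟨
    ap β (a * u)    ≈⟨ ap-cong β (trans (*-congʳ a≈0) (zeroˡ u)) ⟩
    ap β 0#         ≈⟨ ap-0 β ⟩
    0#              ∎)))
    where open SetoidReasoning setoid

  witness⇒SamePoint-quot : ∀ {a b} → NonzeroPair (a , b) → NonDistanceWitness a b →
                           ∃ λ w → Σ (¬ w ≈ 0#) λ w≉0 → SamePoint (ρ a , ρ b) (ρ 1# , ρ (quot β w w≉0))
  witness⇒SamePoint-quot {a} {b} ab≉0 (u , u≉0 , βau≈bu) =
    a * u , au≉0 , Equivalence.from (SamePoint-ρ⇔ a≉0 1≉0 b≈qa (sym (*-identityʳ _))) refl
    where
    open SetoidReasoning setoid
    a≉0 = witness⇒a≉0 ab≉0 (u , u≉0 , βau≈bu)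
    au≉0 = x≉0∧y≉0⇒x*y≉0 a≉0 u≉0
    b≈qa : b ≈ quot β (a * u) au≉0 * a
    b≈qa = *-cancelʳ u≉0 (begin
      b * u                             ≈⟨ βau≈bu ⟨
      ap β (a * u)                      ≈⟨ quot-* β au≉0 ⟨
      quot β (a * u) au≉0 * (a * u)     ≈⟨ *-assoc _ _ _ ⟨
      quot β (a * u) au≉0 * a * u       ∎)

  nonDistant⇒SamePoint-quot : ∀ {a b} → NonDistF T (a , b) →
                              ∃ λ u → Σ (¬ u ≈ 0#) λ u≉0 → SamePoint (ρ a , ρ b) (ρ 1# , ρ (quot β u u≉0))
  nonDistant⇒SamePoint-quot (ab≉0 , ¬distant) = witness⇒SamePoint-quot ab≉0 (¬distant⇒witness ¬distant)

  quot-nonDistant : ∀ u (u≉0 : ¬ u ≈ 0#) → NonDistF T (1# , quot β u u≉0)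
  quot-nonDistant u u≉0 = 1≉0 ∘ proj₁ ,
    witness⇒¬distant (u , u≉0 , trans (ap-cong β (*-identityˡ u)) (sym (quot-* β u≉0)))

  InL⇔SamePoint-quot : ∀ P → InL T P ⇔ (∃ λ u → Σ (¬ u ≈ 0#) λ u≉0 → SamePoint P (1E , ρ (quot β u u≉0)))
  InL⇔SamePoint-quot P = mk⇔ to from
    where
    to : InL T P → ∃ λ u → Σ (¬ u ≈ 0#) λ u≉0 → SamePoint P (1E , ρ (quot β u u≉0))
    to (a , b , nonDistant , P~ab) =
      let u , u≉0 , ab~quot = nonDistant⇒SamePoint-quot nonDistant in
      u , u≉0 , (begin
        P                            ≈⟨ P~ab ⟩
        ρ a , ρ b                    ≈⟨ ab~quot ⟩
        ρ 1# , ρ (quot β u u≉0)      ≈⟨ SamePoint-ρ1 (ρ (quot β u u≉0)) ⟩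
        1E , ρ (quot β u u≉0)        ∎)
      where open SetoidReasoning pointsE
    from : (∃ λ u → Σ (¬ u ≈ 0#) λ u≉0 → SamePoint P (1E , ρ (quot β u u≉0))) → InL T P
    from (u , u≉0 , P~quot) = 1# , quot β u u≉0 , quot-nonDistant u u≉0 , (begin
        P                            ≈⟨ P~quot ⟩
        1E , ρ (quot β u u≉0)        ≈⟨ SamePoint-ρ1 (ρ (quot β u u≉0)) ⟨
        ρ 1# , ρ (quot β u u≉0)      ∎)
      where open SetoidReasoning pointsE

  singular⇔InL-origin : Singular β ⇔ InL T (1E , 0E)
  singular⇔InL-origin = mk⇔ to from
    where
    to : Singular β → InL T (1E , 0E)
    to (u , u≉0 , βu≈0) = 1# , 0# ,
      (1≉0 ∘ proj₁ , witness⇒¬distant (u , u≉0 , trans (ap-cong β (*-identityˡ u)) (trans βu≈0 (sym (zeroˡ u))))) ,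
      SamePoint-≈E 1E 0E (ρ 1#) (ρ 0#) (sym ∘ *-identityˡ) (sym ∘ zeroˡ)
    from : InL T (1E , 0E) → Singular β
    from (a , b , (ab≉0 , ¬distant) , _ , _ , _ , bx≈0) = witness⇒singular (¬distant⇒witness ¬distant)
      where
      b≈0 : b ≈ 0#
      b≈0 = trans (sym (*-identityʳ b)) (bx≈0 1#)
      witness⇒singular : NonDistanceWitness a b → Singular β
      witness⇒singular (u , u≉0 , βau≈bu) =
        a * u , x≉0∧y≉0⇒x*y≉0 (witness⇒a≉0 ab≉0 (u , u≉0 , βau≈bu)) u≉0 ,
        trans βau≈bu (trans (*-congʳ b≈0) (zeroˡ u))

module ScatteredPoint {c ℓ k} (R : CommutativeRing c ℓ) (Fs : FieldStr R)
                      (K : CommutativeRing.Carrier R → Set k) (KS : IsSubfield R Fs K)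
                      {q t} (EK : Enumerations.Enumeration (CommutativeRing.setoid R) K q)
                      (EF : Enumerations.Enumeration (CommutativeRing.setoid R) (λ _ → ⊤ {k}) (q ^ t))
                      (β : Setup.End R Fs K) (scattered : Setup.Scattered R Fs K q t (Setup.1E R Fs K , β)) where
  open CommutativeRing R
  open IsSubfield KS
  open Setup R Fs K
  open FieldProperties R Fs
  open Enumerations setoid using (Enumeration; HasSizeMod⇒Enumeration; without)
  open Enumerations.Finite setoid EF using (_≟_)
  open LinearAlgebra R Fs K KS hiding (module OverFiniteField)
  open LinearAlgebra.OverFiniteField R Fs K KS EF using (singular?; distinct-lines-bound)
  open PointsOfProjectiveLine R Fs K KS
  open NonDistantPoints R Fs K KS EF β

  N : ℕ
  N = θ q t

  module L = Enumerations.Enumeration (Enumerations.HasSizeMod⇒Enumeration pointsF scattered)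

  W : Fin N → Carrier
  W i = proj₁ (nonDistant⇒SamePoint-quot (L.enum-P i))

  W≉0 : ∀ i → ¬ W i ≈ 0#
  W≉0 i = proj₁ (proj₂ (nonDistant⇒SamePoint-quot (L.enum-P i)))

  r : Fin N → Carrier
  r i = quot β (W i) (W≉0 i)

  L~r : ∀ i → SamePoint (ρ² (L.enum i)) (ρ 1# , ρ (r i))
  L~r i = proj₂ (proj₂ (nonDistant⇒SamePoint-quot (L.enum-P i)))

  quotEnumeration : Enumeration (InI β) N
  quotEnumeration = record
    { enum       = r
    ; enum-P     = λ i → W i , W≉0 i , refl
    ; enum-inj   = λ {i} {j} rᵢ≈rⱼ → L.enum-inj (begin
        L.enum i    ≈⟨ L~r i ⟩
        (1# , r i)  ≈⟨ Equivalence.from SamePoint-ρ1⇔ rᵢ≈rⱼ ⟩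
        (1# , r j)  ≈⟨ L~r j ⟨
        L.enum j    ∎)
    ; index      = λ _ (u , u≉0 , _) → L.index (1# , quot β u u≉0) (quot-nonDistant u u≉0)
    ; enum-index = λ x (u , u≉0 , x≈qu) → trans x≈qu (Equivalence.to SamePoint-ρ1⇔ (begin
        (1# , quot β u u≉0)  ≈⟨ L.enum-index _ (quot-nonDistant u u≉0) ⟩
        L.enum _             ≈⟨ L~r _ ⟩
        (1# , r _)           ∎))
    }
    where open SetoidReasoning pointsF

  open Enumeration quotEnumeration using (index; enum-index; enum-inj)

  K* : Enumeration (λ x → K x × ¬ x ≈ 0#) (q ∸ 1)
  K* = without EK K-0

  -- a vector with quotient r i off the line of W i would lie on an (N+1)-st line
  ¬¬quot≈r⇒∈⟨W⟩ : ∀ {x} (x≉0 : ¬ x ≈ 0#) i → quot β x x≉0 ≈ r i → ¬ ¬ x ∈⟨ W i ⟩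
  ¬¬quot≈r⇒∈⟨W⟩ {x} x≉0 i qx≈rᵢ x∉⟨Wᵢ⟩ = too-many (distinct-lines-bound K* (x ∷ W) X≉0 X-distinct)
    where
    x∉⟨W⟩ : ∀ j → ¬ x ∈⟨ W j ⟩
    x∉⟨W⟩ j x∈⟨Wⱼ⟩ = x∉⟨Wᵢ⟩ (≡.subst (λ j → x ∈⟨ W j ⟩) j≡i x∈⟨Wⱼ⟩)
      where
      j≡i : j ≡ i
      j≡i = enum-inj (trans (sym (∈⟨⟩⇒quot≈ β x≉0 (W≉0 j) x∈⟨Wⱼ⟩)) qx≈rᵢ)

    X≉0 : ∀ j → ¬ (x ∷ W) j ≈ 0#
    X≉0 zero    = x≉0
    X≉0 (suc j) = W≉0 j

    X-distinct : ∀ {j j'} → (x ∷ W) j ∈⟨ (x ∷ W) j' ⟩ → j ≡ j'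
    X-distinct {zero}  {zero}   _       = ≡.refl
    X-distinct {zero}  {suc j'} x∈⟨W⟩   = contradiction x∈⟨W⟩ (x∉⟨W⟩ j')
    X-distinct {suc j} {zero}   W∈⟨x⟩   = contradiction (∈⟨⟩-sym (W≉0 j) W∈⟨x⟩) (x∉⟨W⟩ j)
    X-distinct {suc j} {suc j'} W∈⟨W⟩   = ≡.cong suc (enum-inj (∈⟨⟩⇒quot≈ β (W≉0 j) (W≉0 j') W∈⟨W⟩))

    too-many : ¬ suc (suc N ℕ.* (q ∸ 1)) ≤ q ^ t
    too-many bound = ℕ.<⇒≱ (ℕ.m<n+m (N ℕ.* (q ∸ 1)) q∸1>0)
      (ℕ.≤-pred (ℕ.≤-trans bound (ℕ.≤-reflexive (q^t≡1+θ*[q∸1] q t {{q≢0}}))))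
      where
      q≢0 = Fin.nonZeroIndex (Enumeration.index EK 0# K-0)
      q∸1>0 = ℕ.>-nonZero⁻¹ (q ∸ 1) {{Fin.nonZeroIndex (Enumeration.index K* 1# (K-1 , 1≉0))}}

  quot≈r⇒∈⟨W⟩ : ∀ {x} (x≉0 : ¬ x ≈ 0#) i → quot β x x≉0 ≈ r i → x ∈⟨ W i ⟩
  quot≈r⇒∈⟨W⟩ {x} x≉0 i qx≈rᵢ = decidable-stable
    (Enumeration.search EK (λ y → x ≟ y * W i) (λ y≈y' x≈yW → trans x≈yW (*-congʳ y≈y')))
    (¬¬quot≈r⇒∈⟨W⟩ x≉0 i qx≈rᵢ)

  quot≈⇒∈⟨⟩ : ∀ {u v} (u≉0 : ¬ u ≈ 0#) (v≉0 : ¬ v ≈ 0#) → quot β u u≉0 ≈ quot β v v≉0 → u ∈⟨ v ⟩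
  quot≈⇒∈⟨⟩ {u} {v} u≉0 v≉0 qu≈qv =
    ∈⟨⟩-trans (quot≈r⇒∈⟨W⟩ u≉0 i qu≈rᵢ) (∈⟨⟩-sym v≉0 (quot≈r⇒∈⟨W⟩ v≉0 i (trans (sym qu≈qv) qu≈rᵢ)))
    where
    i = index _ (u , u≉0 , refl)
    qu≈rᵢ = enum-index _ (u , u≉0 , refl)

  LinDep⇔quot≈ : ∀ {u v} (u≉0 : ¬ u ≈ 0#) (v≉0 : ¬ v ≈ 0#) → LinDep u v ⇔ (quot β u u≉0 ≈ quot β v v≉0)
  LinDep⇔quot≈ u≉0 v≉0 = mk⇔ (∈⟨⟩⇒quot≈ β u≉0 v≉0) (quot≈⇒∈⟨⟩ u≉0 v≉0) ⇔-∘ LinDep⇔∈⟨⟩ v≉0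

  kernel-dim≤1 : KerDim≤1 β
  kernel-dim≤1 = spanning-vector (singular? β)
    where
    spanning-vector : Dec (Singular β) → KerDim≤1 β
    spanning-vector (yes (v , v≉0 , βv≈0)) = v , βv≈0 , λ x βx≈0 → in-line x βx≈0 (x ≟ 0#)
      where
      in-line : ∀ x → ap β x ≈ 0# → Dec (x ≈ 0#) → x ∈⟨ v ⟩
      in-line x _     (yes x≈0) = ≈0⇒∈⟨⟩ x≈0
      in-line x βx≈0  (no  x≉0) = quot≈⇒∈⟨⟩ x≉0 v≉0 (trans (quot≈0 β x≉0 βx≈0) (sym (quot≈0 β v≉0 βv≈0)))
    spanning-vector (no ¬singular) = 0# , ap-0 β , λ x βx≈0 →
      ≈0⇒∈⟨⟩ (decidable-stable (x ≟ 0#) (λ x≉0 → ¬singular (x , x≉0 , βx≈0)))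

proposition8 : {c ℓ k : Level} (q t : ℕ)
    → (Σ ℕ λ p → Σ ℕ λ e → Prime p × (q ≡ p ^ e))
    → 2 ≤ t
    → (R : CommutativeRing c ℓ) (Fs : FieldStr R)
    → (K : CommutativeRing.Carrier R → Set k) → IsSubfield R Fs K
    → HasSizeMod (CommutativeRing._≈_ R) K q
    → HasSizeMod (CommutativeRing._≈_ R) (λ _ → ⊤ {k}) (q ^ t)
    → let open CommutativeRing R
          open Setup R Fs K
      in (β : End)
    → Scattered q t (1E , β)
    → -- (i)
      (∀ γ δ → Admissible γ δ →
         InL (1E , β) (γ , δ) ⇔ (Σ Carrier λ u → Σ (¬ (u ≈ 0#)) λ nz → SamePoint (γ , δ) (1E , ρ (quot β u nz))))
      -- (ii)
    × HasSizeMod _≈_ (InI β) (θ q t)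
      -- (iii)
    × (∀ u v (nzu : ¬ (u ≈ 0#)) (nzv : ¬ (v ≈ 0#)) → LinDep u v ⇔ (quot β u nzu ≈ quot β v nzv))
      -- (iv)
    × KerDim≤1 β
      -- (v)
    × ((¬ IsUnitE β) ⇔ InL (1E , β) (1E , 0E))
proposition8 q t _ _ R Fs K KS |K|≡q |F|≡q^t β scattered =
  (λ γ δ _ → InL⇔SamePoint-quot (γ , δ)) ,
  Enumeration⇒HasSizeMod quotEnumeration ,
  (λ _ _ → LinDep⇔quot≈) ,
  kernel-dim≤1 ,
  singular⇔InL-origin ⇔-∘ ¬unit⇔singular β
  where
  open Enumerations (CommutativeRing.setoid R) using (HasSizeMod⇒Enumeration; Enumeration⇒HasSizeMod)
  EF = HasSizeMod⇒Enumeration |F|≡q^t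
  open LinearAlgebra.OverFiniteField R Fs K KS EF using (¬unit⇔singular)
  open NonDistantPoints R Fs K KS EF β using (InL⇔SamePoint-quot; singular⇔InL-origin)
  open ScatteredPoint R Fs K KS (HasSizeMod⇒Enumeration |K|≡q) EF β scattered
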